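{- There is a connected $4$-colouring of $K_{17}^{(3)}$ with no multicoloured $4$-set.
   Context: $K_n^{(3)}$ is the $3$-uniform hypergraph on $n$ vertices whose edges are all $3$-subsets. A strong path in a $3$-graph is a sequence of edges $E_1,\dots,E_m$ with $|E_j\cap E_{j+1}|=2$ for all $j$. A $3$-graph $H$ on vertex set $V$ is connected if for any two distinct $2$-subsets $\{u,v\},\{u',v'\}$ of $V$ there is a strong path $E_1,\dots,E_m$ in $H$ with $\{u,v\}\subset E_1$ and $\{u',v'\}\subset E_m$. A colouring of the edges of $K_n^{(3)}$ with $k$ colours is a connected $k$-colouring if, for each colour, the $3$-graph on all $n$ vertices formed by the edges of that colour is connected. A $4$-set of vertices is multicoloured if its four $3$-subsets receive four distinct colours. -}

module Defs where

open import Data.Nat using (ℕ)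
open import Data.Fin using (Fin; _<_)
open import Data.Product using (Σ; ∃; ∃-syntax; _×_; _,_)
open import Data.Sum using (_⊎_)
open import Relation.Binary.PropositionalEquality using (_≡_; _≢_)
open import Relation.Nullary using (¬_)

-- A 3-subset of the vertex set Fin n, written in increasing order a < b < c.
record Edge (n : ℕ) : Set where
  constructor edge
  field
    a b c : Fin n
    a<b : a < b
    b<c : b < c

record Pair (n : ℕ) : Set where
  constructor pair
  field
    u v : Fin n
    u<v : u < v

open Edge
open Pair

_∈E_ : {n : ℕ} → Fin n → Edge n → Set
x ∈E e = (x ≡ a e) ⊎ (x ≡ b e) ⊎ (x ≡ c e)

_⊆E_ : {n : ℕ} → Pair n → Edge n → Set
p ⊆E e = (u p ∈E e) × (v p ∈E e)

-- |E ∩ E'| = 2 : the edges are distinct and share a 2-subset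
Adj : {n : ℕ} → Edge n → Edge n → Set
Adj {n} e e' = (e ≢ e') × (Σ (Pair n) λ p → (p ⊆E e) × (p ⊆E e'))

3Graph : ℕ → Set₁
3Graph n = Edge n → Set

data StrongPath {n : ℕ} (H : 3Graph n) : Edge n → Edge n → Set where
  single : ∀ {E} → H E → StrongPath H E E
  step   : ∀ {E E' F} → H E → Adj E E' → StrongPath H E' F → StrongPath H E F

Connected : {n : ℕ} → 3Graph n → Set
Connected {n} H =
  (p q : Pair n) → p ≢ q →
  ∃[ E ] ∃[ F ] ((p ⊆E E) × (q ⊆E F) × StrongPath H E F)

Colouring : ℕ → ℕ → Set
Colouring n k = Edge n → Fin k

ColourClass : {n k : ℕ} → Colouring n k → Fin k → 3Graph n
ColourClass χ i E = χ E ≡ i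

ConnectedColouring : {n k : ℕ} → Colouring n k → Set
ConnectedColouring {k = k} χ = (i : Fin k) → Connected (ColourClass χ i)

AllDistinct4 : {A : Set} → A → A → A → A → Set
AllDistinct4 w x y z =
  (w ≢ x) × (w ≢ y) × (w ≢ z) × (x ≢ y) × (x ≢ z) × (y ≢ z)

Multicoloured : {n k : ℕ} → Colouring n k → Set
Multicoloured {n} χ =
  Σ (Fin n) λ a → Σ (Fin n) λ b → Σ (Fin n) λ c → Σ (Fin n) λ d →
  Σ (a < b) λ ab → Σ (b < c) λ bc → Σ (c < d) λ cd →
    AllDistinct4 (χ (edge a b c ab bc)) (χ (edge a b d ab (Data.Fin.Properties.<-trans bc cd)))
                 (χ (edge a c d (Data.Fin.Properties.<-trans ab bc) cd)) (χ (edge b c d bc cd))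
  where import Data.Fin.Properties

-- A triple {a < b < c} of Z/17 cuts the 17-cycle into arcs of lengths b − a, c − b and
-- 17 − (c − a); the colour of a triple depends only on this partition of 17 into three parts,
-- so the colouring is invariant under the dihedral group of the 17-gon.  The colours of the
-- 24 partitions were found by computer search.
-- For connectedness, a breadth-first search grows inside each colour class a tree of strong
-- paths towards one hub edge; once every pair of vertices lies in an edge of that tree, any
-- two pairs are joined through the hub.

module Submission where

open import Defs
open import Data.Nat using (ℕ; suc; _∸_; _⊓_; _⊔_)
open import Data.Fin using (Fin; toℕ; _<_)
open import Data.Fin.Patterns using (0F; 1F; 2F; 3F)
open import Data.Fin.Properties using (_≟_; _<?_; <-trans; <-irrelevant; any?; all?)
open import Data.List using (List; []; _∷_; _++_; [_]; allFin; concatMap; mapMaybe; head; length; partitionSumsWith)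
open import Data.Maybe using (Maybe; just; nothing; is-just; to-witness-T; from-just)
import Data.Maybe as Maybe
open import Data.Product using (Σ; ∃-syntax; _×_; _,_; proj₁)
open import Data.Sum using (_⊎_; inj₁; inj₂)
open import Function using (_∘_)
open import Relation.Nullary using (¬_; Dec; yes; no; ¬?)
open import Relation.Nullary.Decidable using (_⊎-dec_; _×-dec_; T?; dec⇒maybe; from-no)
open import Relation.Unary using (Decidable)
open import Relation.Binary.PropositionalEquality using (_≡_; refl; sym; cong; cong₂; subst)

open Edge
open Pair

private
  variable
    n : ℕ
    H : 3Graph n

Adj-sym : {E F : Edge n} → Adj E F → Adj F E
Adj-sym (E≢F , p , p⊆E , p⊆F) = E≢F ∘ sym , p , p⊆F , p⊆E

StrongPath-start : {E F : Edge n} → StrongPath H E F → H E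
StrongPath-start (single hE)   = hE
StrongPath-start (step hE _ _) = hE

_◅◅_ : {E F G : Edge n} → StrongPath H E F → StrongPath H F G → StrongPath H E G
single _     ◅◅ π = π
step hE E~ ρ ◅◅ π = step hE E~ (ρ ◅◅ π)

reverse : {E F : Edge n} → StrongPath H E F → StrongPath H F E
reverse (single hE)     = single hE
reverse (step hE E~F π) = reverse π ◅◅ step (StrongPath-start π) (Adj-sym E~F) (single hE)

Linked : 3Graph n → Edge n → Fin n → Fin n → Set
Linked H O x y = ∃[ E ] (x ∈E E × y ∈E E) × StrongPath H E O

connected-via-hub : (O : Edge n) → (∀ x y → Linked H O x y) → Connected H
connected-via-hub O linked (pair x y _) (pair x′ y′ _) _
  with linked x y | linked x′ y′
... | E , xy⊆E , E⇝O | F , xy⊆F , F⇝O = E , F , xy⊆E , xy⊆F , E⇝O ◅◅ reverse F⇝O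

_≟ₑ_ : (E F : Edge n) → Dec (E ≡ F)
edge a b c a<b b<c ≟ₑ edge a′ b′ c′ a′<b′ b′<c′ with a ≟ a′ | b ≟ b′ | c ≟ c′
... | yes refl | yes refl | yes refl =
  yes (cong₂ (edge a b c) (<-irrelevant a<b a′<b′) (<-irrelevant b<c b′<c′))
... | no a≢a′ | _       | _       = no (a≢a′ ∘ cong Edge.a)
... | _       | no b≢b′ | _       = no (b≢b′ ∘ cong Edge.b)
... | _       | _       | no c≢c′ = no (c≢c′ ∘ cong Edge.c)

_∈E?_ : (x : Fin n) (E : Edge n) → Dec (x ∈E E)
x ∈E? E = x ≟ a E ⊎-dec x ≟ b E ⊎-dec x ≟ c E

sides : (E : Edge n) → List (Σ (Pair n) (_⊆E E))
sides (edge a b c a<b b<c) =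
  (pair a b a<b , inj₁ refl , inj₂ (inj₁ refl)) ∷
  (pair a c (<-trans a<b b<c) , inj₁ refl , inj₂ (inj₂ refl)) ∷
  (pair b c b<c , inj₂ (inj₁ refl) , inj₂ (inj₂ refl)) ∷ []

commonPair? : (E F : Edge n) → Maybe (Σ (Pair n) λ p → p ⊆E E × p ⊆E F)
commonPair? E F = head (mapMaybe inF (sides E))
  where
  inF : Σ (Pair _) (_⊆E E) → Maybe (Σ (Pair _) λ p → p ⊆E E × p ⊆E F)
  inF (p , p⊆E) = Maybe.map (λ p⊆F → p , p⊆E , p⊆F) (dec⇒maybe (u p ∈E? F ×-dec v p ∈E? F))

adjacent? : (E F : Edge n) → Maybe (Adj E F)
adjacent? E F with E ≟ₑ F
... | yes _  = nothing
... | no E≢F = Maybe.map (E≢F ,_) (commonPair? E F)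

edges : (n : ℕ) → List (Edge n)
edges n = concatMap (λ a → concatMap (λ b → concatMap (triangle a b) (allFin n)) (allFin n)) (allFin n)
  where
  triangle : Fin n → Fin n → Fin n → List (Edge n)
  triangle a b c with a <? b | b <? c
  ... | yes a<b | yes b<c = [ edge a b c a<b b<c ]
  ... | _       | _       = []

-- A sound search: a result is a proof, so the fuel only has to suffice for the instances at hand.
module ConnectivitySearch {H : 3Graph n} (H? : Decidable H) where

  edgesIn : List (Σ (Edge n) H)
  edgesIn = mapMaybe (λ E → Maybe.map (E ,_) (dec⇒maybe (H? E))) (edges n)

  PathsTo : Edge n → Set
  PathsTo O = List (Σ (Edge n) λ E → StrongPath H E O)

  attach : {O : Edge n} → PathsTo O → Σ (Edge n) H → Σ (Edge n) H ⊎ Σ (Edge n) λ F → StrongPath H F O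
  attach []                  F        = inj₁ F
  attach ((E , E⇝O) ∷ paths) (F , hF) with adjacent? F E
  ... | just F~E = inj₂ (F , step hF F~E E⇝O)
  ... | nothing  = attach paths (F , hF)

  explore : {O : Edge n} → ℕ → List (Σ (Edge n) H) → PathsTo O → PathsTo O
  explore 0       _       paths = paths
  explore (suc k) pending paths with partitionSumsWith (attach paths) pending
  ... | pending′ , attached = explore k pending′ (attached ++ paths)

  linked? : {O : Edge n} → PathsTo O → (x y : Fin n) → Maybe (Linked H O x y)
  linked? []                  x y = nothing
  linked? ((E , E⇝O) ∷ paths) x y with x ∈E? E ×-dec y ∈E? E
  ... | yes xy⊆E = just (E , xy⊆E , E⇝O)
  ... | no _     = linked? paths x y

  allLinked? : {O : Edge n} → PathsTo O → Maybe (∀ x y → Linked H O x y)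
  allLinked? paths = Maybe.map (λ ok x y → to-witness-T _ (ok x y))
    (dec⇒maybe (all? λ x → all? λ y → T? (is-just (linked? paths x y))))

  connected? : Maybe (Connected H)
  connected? with edgesIn
  ... | []              = nothing
  ... | (O , hO) ∷ rest =
    Maybe.map (connected-via-hub O) (allLinked? (explore (length rest) rest [ O , single hO ]))

Σ<? : {x y : Fin n} {P : x < y → Set} → (∀ x<y → Dec (P x<y)) → Dec (Σ (x < y) P)
Σ<? {x = x} {y} {P} P? with x <? y
... | no x≮y = no (x≮y ∘ proj₁)
... | yes x<y with P? x<y
...   | yes p = yes (x<y , p)
...   | no ¬p = no λ { (x<y′ , p) → ¬p (subst P (<-irrelevant x<y′ x<y) p) }

allDistinct4? : {k : ℕ} (w x y z : Fin k) → Dec (AllDistinct4 w x y z)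
allDistinct4? w x y z =
  ¬? (w ≟ x) ×-dec ¬? (w ≟ y) ×-dec ¬? (w ≟ z) ×-dec ¬? (x ≟ y) ×-dec ¬? (x ≟ z) ×-dec ¬? (y ≟ z)

multicoloured? : {k : ℕ} (χ : Colouring n k) → Dec (Multicoloured χ)
multicoloured? χ =
  any? λ a → any? λ b → any? λ c → any? λ d → Σ<? λ ab → Σ<? λ bc → Σ<? λ cd →
    allDistinct4? (χ (edge a b c ab bc)) (χ (edge a b d ab (<-trans bc cd)))
                  (χ (edge a c d (<-trans ab bc) cd)) (χ (edge b c d bc cd))

arcColour : ℕ → ℕ → ℕ → Fin 4
arcColour 1 1 15 = 3F
arcColour 1 2 14 = 1F
arcColour 1 3 13 = 0F
arcColour 1 4 12 = 1F
arcColour 1 5 11 = 3F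
arcColour 1 6 10 = 2F
arcColour 1 7 9 = 3F
arcColour 1 8 8 = 1F
arcColour 2 2 13 = 0F
arcColour 2 3 12 = 1F
arcColour 2 4 11 = 1F
arcColour 2 5 10 = 2F
arcColour 2 6 9 = 0F
arcColour 2 7 8 = 1F
arcColour 3 3 11 = 1F
arcColour 3 4 10 = 0F
arcColour 3 5 9 = 1F
arcColour 3 6 8 = 3F
arcColour 3 7 7 = 2F
arcColour 4 4 9 = 3F
arcColour 4 5 8 = 2F
arcColour 4 6 7 = 1F
arcColour 5 5 7 = 2F
arcColour 5 6 6 = 0F
-- Only the 24 partitions of 17 occur as arguments.
arcColour _ _ _ = 0F

colour : Colouring 17 4
colour (edge a b c _ _) = arcColour shortest (17 ∸ shortest ∸ longest) longest
  where
  x = toℕ b ∸ toℕ a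
  y = toℕ c ∸ toℕ b
  z = 17 ∸ (toℕ c ∸ toℕ a)
  shortest = x ⊓ y ⊓ z
  longest  = x ⊔ y ⊔ z

colour-connected : ConnectedColouring colour
colour-connected 0F = from-just (ConnectivitySearch.connected? (λ E → colour E ≟ 0F))
colour-connected 1F = from-just (ConnectivitySearch.connected? (λ E → colour E ≟ 1F))
colour-connected 2F = from-just (ConnectivitySearch.connected? (λ E → colour E ≟ 2F))
colour-connected 3F = from-just (ConnectivitySearch.connected? (λ E → colour E ≟ 3F))

proposition10 : Σ (Colouring 17 4) λ χ → ConnectedColouring χ × ¬ Multicoloured χ
proposition10 = colour , colour-connected , from-no (multicoloured? colour)
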